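{- Let $m\ge 3$, $n\ge 1$ and $k\ge 1$ be integers, and let $G=C_m\Box P_n$. The following statements are equivalent: (1) $G$ admits an efficient dominating set; (2) there exists a $[k]$-Roman dominating function $f:V(G)\to\{0,1,\dots,k+1\}$ such that $\sum_{u\in N[v]} f(u)=k+1$ for every $v\in V(G)$; (3) $G$ is either $C_m\Box P_1$ with $m\equiv 0 \pmod 3$, or $C_m\Box P_2$ with $m\equiv 0\pmod 4$.
   Context: For a graph $G$ and $v\in V(G)$, $N(v)$ is the open neighborhood and $N[v]=N(v)\cup\{v\}$ the closed neighborhood. For an integer $k\ge1$, a function $f:V(G)\to\{0,1,\dots,k+1\}$ is a $[k]$-Roman dominating function ($[k]$-RDF) if for every vertex $v$ with $f(v)<k$ we have $f(N[v])\ge k+|AN(v)|$, where $f(S)=\sum_{u\in S}f(u)$ and $AN(v)=\{u\in N(v): f(u)>0\}$. A set $D\subseteq V(G)$ is an efficient dominating set if every vertex $v\in V(G)$ lies in $N[u]$ for exactly one $u\in D$. $P_n$ is the path on vertices $\{0,\dots,n-1\}$, $C_m$ the cycle on $\{0,\dots,m-1\}$ (indices mod $m$), and $C_m\Box P_n$ is their Cartesian product: vertex set $V(C_m)\times V(P_n)$, with $(i,j)$ adjacent to $(i',j')$ iff either $i=i'$ and $jj'\in E(P_n)$, or $j=j'$ and $ii'\in E(C_m)$. -}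

module Defs where

open import Data.Nat using (ℕ; zero; suc; _+_; _*_; _∸_; _≤_; _<_; _≟_)
open import Data.Fin using (Fin; toℕ)
open import Data.Fin.Properties using () renaming (_≟_ to _≟ᶠ_)
open import Data.Product using (Σ; _×_; _,_; ∃; ∃-syntax)
open import Data.Product.Properties using (≡-dec)
open import Data.Sum using (_⊎_)
open import Data.Bool using (Bool; true; false; if_then_else_)
open import Data.Nat.ListAction using (sum)
open import Data.List using (List; map; concatMap; length; filter)
open import Data.List.Base using (allFin)
open import Relation.Nullary using (Dec; ¬_)
open import Relation.Nullary.Decidable using (⌊_⌋; _×-dec_; _⊎-dec_)
open import Relation.Binary.PropositionalEquality using (_≡_)

V : ℕ → ℕ → Set
V m n = Fin m × Fin n

CycAdj : {m : ℕ} → Fin m → Fin m → Set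
CycAdj {m} i i' =
  (toℕ i' ≡ suc (toℕ i)) ⊎ (toℕ i ≡ suc (toℕ i')) ⊎
  ((toℕ i ≡ 0 × toℕ i' ≡ m ∸ 1) ⊎ (toℕ i' ≡ 0 × toℕ i ≡ m ∸ 1))

PathAdj : {n : ℕ} → Fin n → Fin n → Set
PathAdj j j' = (toℕ j' ≡ suc (toℕ j)) ⊎ (toℕ j ≡ suc (toℕ j'))

Adj : {m n : ℕ} → V m n → V m n → Set
Adj (i , j) (i' , j') = (i ≡ i' × PathAdj j j') ⊎ (j ≡ j' × CycAdj i i')

cycAdj? : {m : ℕ} (i i' : Fin m) → Dec (CycAdj i i')
cycAdj? {m} i i' =
  (toℕ i' ≟ suc (toℕ i)) ⊎-dec (toℕ i ≟ suc (toℕ i')) ⊎-dec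
  ((toℕ i ≟ 0 ×-dec toℕ i' ≟ m ∸ 1) ⊎-dec (toℕ i' ≟ 0 ×-dec toℕ i ≟ m ∸ 1))

pathAdj? : {n : ℕ} (j j' : Fin n) → Dec (PathAdj j j')
pathAdj? j j' = (toℕ j' ≟ suc (toℕ j)) ⊎-dec (toℕ j ≟ suc (toℕ j'))

adj? : {m n : ℕ} (u v : V m n) → Dec (Adj u v)
adj? (i , j) (i' , j') = ((i ≟ᶠ i') ×-dec pathAdj? j j') ⊎-dec ((j ≟ᶠ j') ×-dec cycAdj? i i')

_≟ᵥ_ : {m n : ℕ} (u v : V m n) → Dec (u ≡ v)
_≟ᵥ_ = ≡-dec _≟ᶠ_ _≟ᶠ_

InClosedNbhd : {m n : ℕ} → V m n → V m n → Set
InClosedNbhd u v = (u ≡ v) ⊎ Adj v u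

inClosed? : {m n : ℕ} (u v : V m n) → Dec (InClosedNbhd u v)
inClosed? u v = (u ≟ᵥ v) ⊎-dec adj? v u

vertices : (m n : ℕ) → List (V m n)
vertices m n = concatMap (λ i → map (λ j → (i , j)) (allFin n)) (allFin m)

closedSum : {m n : ℕ} → (V m n → ℕ) → V m n → ℕ
closedSum {m} {n} f v =
  sum (map (λ u → if ⌊ inClosed? u v ⌋ then f u else 0) (vertices m n))

activeNbrCount : {m n : ℕ} → (V m n → ℕ) → V m n → ℕ
activeNbrCount {m} {n} f v =
  length (filter (λ u → adj? v u ×-dec (1 Data.Nat.≤? f u)) (vertices m n))

IsKRDF : (m n k : ℕ) → (V m n → ℕ) → Set
IsKRDF m n k f =
  ((v : V m n) → f v ≤ k + 1) ×
  ((v : V m n) → f v < k → k + activeNbrCount f v ≤ closedSum f v)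

IsEfficientDominating : (m n : ℕ) → (V m n → Bool) → Set
IsEfficientDominating m n D =
  (v : V m n) → ∃[ u ] ((D u ≡ true × InClosedNbhd v u) ×
     ((u' : V m n) → D u' ≡ true → InClosedNbhd v u' → u' ≡ u))

HasEDS : ℕ → ℕ → Set
HasEDS m n = ∃[ D ] IsEfficientDominating m n D

HasPerfectKRDF : ℕ → ℕ → ℕ → Set
HasPerfectKRDF m n k =
  ∃[ f ] (IsKRDF m n k f × ((v : V m n) → closedSum f v ≡ k + 1))

{-# OPTIONS --safe #-}

-- If D is an efficient dominating set, f = (k + 1)·[D] is a [k]-Roman dominating function with
-- f(N[v]) = k + 1 everywhere, since every N[v] contains exactly one member of D. Conversely let f be
-- such a function. A vertex w with f w < k has at most one neighbour u with f u > 0, because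
-- k + |AN(w)| ≤ f(N[w]) = k + 1. Hence if 0 < f v ≤ k, every neighbour w of v has f w > 0
-- (otherwise v is the only positive vertex of N[w] and f(N[w]) = f v ≤ k), and the two cycle
-- neighbours of v contradict either |AN(v)| ≤ 1 (when f v < k) or f(N[v]) = k + 1 (when f v = k).
-- So f only takes the values 0 and k + 1, and {f = k + 1} is an efficient dominating set.
--
-- Two members of an efficient dominating set are at distance at least 3. Chasing which members
-- dominate the vertices next to a member of row 0 shows that the members of row 0 recur with
-- period exactly 3 when n = 1 and exactly 4 when n = 2, so the period divides m; for n ≥ 3 the
-- chase always runs into two members at distance at most 2. Conversely the vertices (i, 0) with
-- i ≡ 0 (mod 3), resp. (i, 0) with i ≡ 0 and (i, 1) with i ≡ 2 (mod 4), are efficient dominating sets.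
module Submission where

open import Defs
open import Level using (0ℓ)
open import Function using (_∘_; case_of_)
open import Function.Bundles using (_⇔_; mk⇔)
open import Data.Bool using (Bool; true; false; if_then_else_)
open import Data.Empty using (⊥; ⊥-elim)
open import Data.Product using (∃; ∃₂; _×_; _,_; proj₁; proj₂)
open import Data.Sum using (_⊎_; inj₁; inj₂)
open import Data.Nat using (ℕ; zero; suc; pred; _+_; _*_; _∸_; _≤_; _≰_; _<_; z≤n; s≤s; NonZero; _≟_; _<?_; _≤?_)
open import Data.Nat.Properties hiding (_≟_; _<?_; _≤?_)
open import Algebra.Properties.CommutativeSemigroup +-commutativeSemigroup using (interchange)
open import Data.Nat.DivMod
open import Data.Nat.Divisibility using (_∣_; m%n≡0⇒n∣m)
open import Data.Nat.ListAction using (sum)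
open import Data.Nat.ListAction.Properties using (sum-++)
open import Data.Fin as Fin using (Fin; toℕ)
open import Data.Fin.Patterns using (0F; 1F; 2F; 3F)
open import Data.Fin.Properties as Finₚ using (toℕ-fromℕ<; toℕ-injective; toℕ<n) renaming (_≟_ to _≟ᶠ_)
open import Data.List as List using (List; []; _∷_; map; concatMap; length; filter; tabulate; allFin)
open import Data.List.Properties using (map-cong; map-cong-local; map-tabulate; tabulate-cong; map-++)
open import Data.List.Relation.Unary.All as All using (All; []; _∷_)
open import Data.List.Relation.Unary.AllPairs using (AllPairs; []; _∷_)
open import Relation.Nullary using (¬_; Dec; does; yes; no; contradiction)
open import Relation.Nullary.Decidable using (⌊_⌋; _×-dec_; dec-true)
open import Relation.Unary using (Pred; Decidable)
open import Relation.Binary.PropositionalEquality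

-- The cycle C_m

suc-%-absorb : ∀ a d .{{_ : NonZero d}} → suc (a % d) % d ≡ suc a % d
suc-%-absorb a d = begin
  (1 + a % d) % d            ≡⟨ %-distribˡ-+ 1 (a % d) d ⟩
  (1 % d + a % d % d) % d    ≡⟨ cong (λ r → (1 % d + r) % d) (m%n%n≡m%n a d) ⟩
  (1 % d + a % d) % d        ≡⟨ %-distribˡ-+ 1 a d ⟨
  (1 + a) % d                ∎
  where open ≡-Reasoning

cycAdj-sym : ∀ {m} {i i' : Fin m} → CycAdj i i' → CycAdj i' i
cycAdj-sym (inj₁ e)               = inj₂ (inj₁ e)
cycAdj-sym (inj₂ (inj₁ e))        = inj₁ e
cycAdj-sym (inj₂ (inj₂ (inj₁ e))) = inj₂ (inj₂ (inj₂ e))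
cycAdj-sym (inj₂ (inj₂ (inj₂ e))) = inj₂ (inj₂ (inj₁ e))

module _ {m : ℕ} .{{_ : NonZero m}} where

  next : Fin m → Fin m
  next i = suc (toℕ i) mod m

  next^ : ℕ → Fin m → Fin m
  next^ zero    i = i
  next^ (suc t) i = next (next^ t i)

  prev : Fin m → Fin m
  prev = next^ (pred m)

  toℕ-next : ∀ i → toℕ (next i) ≡ suc (toℕ i) % m
  toℕ-next i = toℕ-fromℕ< _

  toℕ-next^ : ∀ t i → toℕ (next^ t i) ≡ (toℕ i + t) % m
  toℕ-next^ zero    i = begin
    toℕ i             ≡⟨ m<n⇒m%n≡m (toℕ<n i) ⟨
    toℕ i % m         ≡⟨ cong (_% m) (+-identityʳ (toℕ i)) ⟨
    (toℕ i + 0) % m   ∎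
    where open ≡-Reasoning
  toℕ-next^ (suc t) i = begin
    toℕ (next (next^ t i))     ≡⟨ toℕ-next (next^ t i) ⟩
    suc (toℕ (next^ t i)) % m  ≡⟨ cong (λ r → suc r % m) (toℕ-next^ t i) ⟩
    suc ((toℕ i + t) % m) % m  ≡⟨ suc-%-absorb (toℕ i + t) m ⟩
    suc (toℕ i + t) % m        ≡⟨ cong (_% m) (+-suc (toℕ i) t) ⟨
    (toℕ i + suc t) % m        ∎
    where open ≡-Reasoning

  next^-+ : ∀ a b i → next^ (a + b) i ≡ next^ a (next^ b i)
  next^-+ zero    b i = refl
  next^-+ (suc a) b i = cong next (next^-+ a b i)

  next^-period : ∀ i → next^ m i ≡ i
  next^-period i = toℕ-injective (begin
    toℕ (next^ m i)   ≡⟨ toℕ-next^ m i ⟩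
    (toℕ i + m) % m   ≡⟨ [m+n]%n≡m%n (toℕ i) m ⟩
    toℕ i % m         ≡⟨ m<n⇒m%n≡m (toℕ<n i) ⟩
    toℕ i             ∎)
    where open ≡-Reasoning

  next^-≢ : ∀ {t} i → 0 < t → t < m → next^ t i ≢ i
  next^-≢ {t} i 0<t t<m eq with toℕ i + t <? m
  ... | yes s<m = <-irrefl (begin
    toℕ i              ≡⟨ cong toℕ eq ⟨
    toℕ (next^ t i)    ≡⟨ toℕ-next^ t i ⟩
    (toℕ i + t) % m    ≡⟨ m<n⇒m%n≡m s<m ⟩
    toℕ i + t          ∎) (m<m+n (toℕ i) 0<t)
    where open ≡-Reasoning
  ... | no s≮m = <-irrefl t≡m t<m
    where
    open ≡-Reasoning
    s : ℕ
    s = toℕ i + t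
    m≤s : m ≤ s
    m≤s = ≮⇒≥ s≮m
    s∸m<m : s ∸ m < m
    s∸m<m = ≤-trans (∸-monoˡ-< (+-mono-< (toℕ<n i) t<m) m≤s) (≤-reflexive (m+n∸n≡m m m))
    s∸m≡i : s ∸ m ≡ toℕ i
    s∸m≡i = begin
      s ∸ m            ≡⟨ m<n⇒m%n≡m s∸m<m ⟨
      (s ∸ m) % m      ≡⟨ m≤n⇒[n∸m]%m≡n%m m≤s ⟩
      s % m            ≡⟨ toℕ-next^ t i ⟨
      toℕ (next^ t i)  ≡⟨ cong toℕ eq ⟩
      toℕ i            ∎
    t≡m : t ≡ m
    t≡m = +-cancelˡ-≡ (toℕ i) t m (begin
      toℕ i + t        ≡⟨ m∸n+n≡m m≤s ⟨
      s ∸ m + m        ≡⟨ cong (_+ m) s∸m≡i ⟩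
      toℕ i + m        ∎)

  next≢id : 2 ≤ m → ∀ i → next i ≢ i
  next≢id 2≤m i = next^-≢ {t = 1} i (s≤s z≤n) 2≤m

  next²≢id : 3 ≤ m → ∀ i → next (next i) ≢ i
  next²≢id 3≤m i = next^-≢ {t = 2} i (s≤s z≤n) 3≤m

  next-prev : ∀ i → next (prev i) ≡ i
  next-prev i = trans (cong (λ t → next^ t i) (suc-pred m)) (next^-period i)

  prev-next : ∀ i → prev (next i) ≡ i
  prev-next i = begin
    next^ (pred m) (next^ 1 i)  ≡⟨ next^-+ (pred m) 1 i ⟨
    next^ (pred m + 1) i        ≡⟨ cong (λ t → next^ t i) (trans (+-comm (pred m) 1) (suc-pred m)) ⟩
    next^ m i                   ≡⟨ next^-period i ⟩
    i                           ∎
    where open ≡-Reasoning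

  next-injective : ∀ {i i'} → next i ≡ next i' → i ≡ i'
  next-injective {i} {i'} eq = trans (sym (prev-next i)) (trans (cong prev eq) (prev-next i'))

  toℕ-next-< : ∀ {i} → suc (toℕ i) < m → toℕ (next i) ≡ suc (toℕ i)
  toℕ-next-< {i} lt = trans (toℕ-next i) (m<n⇒m%n≡m lt)

  toℕ-next-last : ∀ {i} → toℕ i ≡ pred m → toℕ (next i) ≡ 0
  toℕ-next-last {i} eq = trans (toℕ-next i) (trans (cong (λ r → suc r % m) eq)
                                                    (trans (cong (_% m) (suc-pred m)) (n%n≡0 m)))

  cycAdj-next : ∀ i → CycAdj i (next i)
  cycAdj-next i with suc (toℕ i) <? m
  ... | yes lt = inj₁ (toℕ-next-< lt)
  ... | no ≮  = inj₂ (inj₂ (inj₂ (toℕ-next-last i≡last , i≡last)))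
    where
    i≡last : toℕ i ≡ pred m
    i≡last = cong pred (≤-antisym (toℕ<n i) (≮⇒≥ ≮))

  cycAdj⇒next : ∀ {i i'} → CycAdj i i' → i' ≡ next i ⊎ i ≡ next i'
  cycAdj⇒next {i} {i'} (inj₁ e) =
    inj₁ (toℕ-injective (trans e (sym (toℕ-next-< (subst (_< m) e (toℕ<n i'))))))
  cycAdj⇒next {i} {i'} (inj₂ (inj₁ e)) =
    inj₂ (toℕ-injective (trans e (sym (toℕ-next-< (subst (_< m) e (toℕ<n i))))))
  cycAdj⇒next (inj₂ (inj₂ (inj₁ (i≡0 , i'≡last)))) =
    inj₂ (toℕ-injective (trans i≡0 (sym (toℕ-next-last i'≡last))))
  cycAdj⇒next (inj₂ (inj₂ (inj₂ (i'≡0 , i≡last)))) =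
    inj₁ (toℕ-injective (trans i'≡0 (sym (toℕ-next-last i≡last))))

  period⇒∣ : (Q : Fin m → Set) (p : ℕ) .{{_ : NonZero p}} →
             (∀ {i} → Q i → Q (next^ p i)) →
             (∀ {i} r → 0 < r → r < p → Q i → ¬ Q (next^ r i)) →
             ∀ {i} → Q i → p ∣ m
  period⇒∣ Q p step separated {i} q with m % p ≟ 0
  ... | yes m%p≡0 = m%n≡0⇒n∣m m p m%p≡0
  ... | no  m%p≢0 = ⊥-elim (separated (m % p) (n≢0⇒n>0 m%p≢0) (m%n<n m p) (multiple (m / p)) (subst Q wraps q))
    where
    multiple : ∀ c → Q (next^ (c * p) i)
    multiple zero    = q
    multiple (suc c) = subst Q (sym (next^-+ p (c * p) i)) (step (multiple c))
    wraps : i ≡ next^ (m % p) (next^ (m / p * p) i)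
    wraps = begin
      i                                       ≡⟨ next^-period i ⟨
      next^ m i                               ≡⟨ cong (λ t → next^ t i) (m≡m%n+[m/n]*n m p) ⟩
      next^ (m % p + m / p * p) i             ≡⟨ next^-+ (m % p) (m / p * p) i ⟩
      next^ (m % p) (next^ (m / p * p) i)     ∎
      where open ≡-Reasoning

residue : ∀ {m} (p : ℕ) .{{_ : NonZero p}} → Fin m → Fin p
residue p i = toℕ i mod p

toℕ-residue : ∀ {m} p .{{_ : NonZero p}} (i : Fin m) → toℕ (residue p i) ≡ toℕ i % p
toℕ-residue p i = toℕ-fromℕ< _

residue-next : ∀ {m p} .{{_ : NonZero m}} .{{_ : NonZero p}} → p ∣ m →
               ∀ i → residue p (next i) ≡ next (residue {m} p i)
residue-next {m} {p} p∣m i = toℕ-injective (begin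
  toℕ (residue p (next i))    ≡⟨ toℕ-residue p (next i) ⟩
  toℕ (next i) % p            ≡⟨ cong (_% p) (toℕ-next i) ⟩
  suc (toℕ i) % m % p         ≡⟨ m∣n⇒o%n%m≡o%m p m (suc (toℕ i)) p∣m ⟩
  suc (toℕ i) % p             ≡⟨ suc-%-absorb (toℕ i) p ⟨
  suc (toℕ i % p) % p         ≡⟨ cong (λ r → suc r % p) (toℕ-residue p i) ⟨
  suc (toℕ (residue p i)) % p ≡⟨ toℕ-next (residue p i) ⟨
  toℕ (next (residue p i))    ∎)
  where open ≡-Reasoning

module _ {A : Set} where

  sum-map-+ : (g h : A → ℕ) (xs : List A) →
              sum (map (λ x → g x + h x) xs) ≡ sum (map g xs) + sum (map h xs)
  sum-map-+ g h []       = refl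
  sum-map-+ g h (x ∷ xs) =
    trans (cong (g x + h x +_) (sum-map-+ g h xs)) (interchange (g x) (h x) (sum (map g xs)) (sum (map h xs)))

  sum-map-positive : (g : A → ℕ) (xs : List A) → 0 < sum (map g xs) → ∃ λ x → 0 < g x
  sum-map-positive g (x ∷ xs) pos with g x in eq
  ... | zero  = sum-map-positive g xs pos
  ... | suc _ = x , subst (0 <_) (sym eq) (s≤s z≤n)

  sum-concatMap : {B : Set} (g : B → ℕ) (h : A → List B) (xs : List A) →
                  sum (map g (concatMap h xs)) ≡ sum (map (λ x → sum (map g (h x))) xs)
  sum-concatMap g h []       = refl
  sum-concatMap g h (x ∷ xs) = begin
    sum (map g (h x List.++ concatMap h xs))                ≡⟨ cong sum (map-++ g (h x) (concatMap h xs)) ⟩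
    sum (map g (h x) List.++ map g (concatMap h xs))        ≡⟨ sum-++ (map g (h x)) _ ⟩
    sum (map g (h x)) + sum (map g (concatMap h xs))        ≡⟨ cong (sum (map g (h x)) +_) (sum-concatMap g h xs) ⟩
    sum (map g (h x)) + sum (map (λ x → sum (map g (h x))) xs) ∎
    where open ≡-Reasoning

  indicator : {P : Pred A 0ℓ} → Decidable P → A → ℕ
  indicator P? x = if does (P? x) then 1 else 0

  length-filter≡sum-indicator : {P : Pred A 0ℓ} (P? : Decidable P) (xs : List A) →
                                length (filter P? xs) ≡ sum (map (indicator P?) xs)
  length-filter≡sum-indicator P? []       = refl
  length-filter≡sum-indicator P? (x ∷ xs) with does (P? x)
  ... | true  = cong suc (length-filter≡sum-indicator P? xs)
  ... | false = length-filter≡sum-indicator P? xs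

  sum-indicator-All : {P : Pred A 0ℓ} (P? : Decidable P) {xs : List A} → All P xs →
                      sum (map (indicator P?) xs) ≡ length xs
  sum-indicator-All P? []                  = refl
  sum-indicator-All P? {x ∷ _} (px ∷ pxs) with P? x
  ... | yes _  = cong suc (sum-indicator-All P? pxs)
  ... | no ¬px = contradiction px ¬px

sum-tabulate-0 : ∀ {k} (F : Fin k → ℕ) → (∀ y → F y ≡ 0) → sum (tabulate F) ≡ 0
sum-tabulate-0 {zero}  F F≡0 = refl
sum-tabulate-0 {suc k} F F≡0 = cong₂ _+_ (F≡0 Fin.zero) (sum-tabulate-0 (F ∘ Fin.suc) (F≡0 ∘ Fin.suc))

sum-tabulate-point : ∀ {k} (F : Fin k → ℕ) x → (∀ y → y ≢ x → F y ≡ 0) → sum (tabulate F) ≡ F x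
sum-tabulate-point F Fin.zero F≡0 =
  trans (cong (F Fin.zero +_) (sum-tabulate-0 (F ∘ Fin.suc) (λ y → F≡0 (Fin.suc y) λ ())))
        (+-identityʳ (F Fin.zero))
sum-tabulate-point F (Fin.suc x) F≡0 =
  cong₂ _+_ (F≡0 Fin.zero λ ())
            (sum-tabulate-point (F ∘ Fin.suc) x λ y y≢x → F≡0 (Fin.suc y) (y≢x ∘ Finₚ.suc-injective))

module _ {m n : ℕ} where

  vsum : (V m n → ℕ) → ℕ
  vsum g = sum (map g (vertices m n))

  vsum-tabulate : ∀ g → vsum g ≡ sum (tabulate λ i → sum (tabulate λ j → g (i , j)))
  vsum-tabulate g = begin
    vsum g                                                     ≡⟨ sum-concatMap g row (allFin m) ⟩
    sum (map (λ i → sum (map g (row i))) (allFin m))           ≡⟨ cong sum (map-tabulate (λ i → i) (λ i → sum (map g (row i)))) ⟩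
    sum (tabulate λ i → sum (map g (row i)))                   ≡⟨ cong sum (tabulate-cong λ i → cong sum (row-tabulate i)) ⟩
    sum (tabulate λ i → sum (tabulate λ j → g (i , j)))        ∎
    where
    open ≡-Reasoning
    row : Fin m → List (V m n)
    row i = map (i ,_) (allFin n)
    row-tabulate : ∀ i → map g (row i) ≡ tabulate λ j → g (i , j)
    row-tabulate i = trans (cong (map g) (map-tabulate (λ j → j) (i ,_))) (map-tabulate (i ,_) g)

  vsum-point : ∀ g x → (∀ u → u ≢ x → g u ≡ 0) → vsum g ≡ g x
  vsum-point g (i₀ , j₀) g≡0 = begin
    vsum g                                                 ≡⟨ vsum-tabulate g ⟩
    sum (tabulate λ i → sum (tabulate λ j → g (i , j)))    ≡⟨ sum-tabulate-point _ i₀ other-row ⟩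
    sum (tabulate λ j → g (i₀ , j))                        ≡⟨ sum-tabulate-point _ j₀ other-column ⟩
    g (i₀ , j₀)                                            ∎
    where
    open ≡-Reasoning
    other-row : ∀ i → i ≢ i₀ → sum (tabulate λ j → g (i , j)) ≡ 0
    other-row i i≢i₀ = sum-tabulate-0 _ λ j → g≡0 (i , j) (i≢i₀ ∘ cong proj₁)
    other-column : ∀ j → j ≢ j₀ → g (i₀ , j) ≡ 0
    other-column j j≢j₀ = g≡0 (i₀ , j) (j≢j₀ ∘ cong proj₂)

  erase : V m n → (V m n → ℕ) → V m n → ℕ
  erase x g u = if does (u ≟ᵥ x) then 0 else g u

  vsum-erase : ∀ g x → vsum g ≡ g x + vsum (erase x g)
  vsum-erase g x = begin
    vsum g                                       ≡⟨ cong sum (map-cong split (vertices m n)) ⟩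
    vsum (λ u → at-x u + erase x g u)             ≡⟨ sum-map-+ at-x (erase x g) (vertices m n) ⟩
    vsum at-x + vsum (erase x g)                  ≡⟨ cong (_+ vsum (erase x g)) (vsum-point at-x x at-x-off) ⟩
    at-x x + vsum (erase x g)                     ≡⟨ cong (_+ vsum (erase x g)) at-x-at ⟩
    g x + vsum (erase x g)                       ∎
    where
    open ≡-Reasoning
    at-x : V m n → ℕ
    at-x u = if does (u ≟ᵥ x) then g x else 0
    split : ∀ u → g u ≡ at-x u + erase x g u
    split u with u ≟ᵥ x
    ... | yes refl = sym (+-identityʳ (g u))
    ... | no _     = refl
    at-x-off : ∀ u → u ≢ x → at-x u ≡ 0
    at-x-off u u≢x with u ≟ᵥ x
    ... | yes u≡x = contradiction u≡x u≢x
    ... | no _    = refl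
    at-x-at : at-x x ≡ g x
    at-x-at with x ≟ᵥ x
    ... | yes _   = refl
    ... | no x≢x  = contradiction refl x≢x

  vsum-distinct : ∀ g {us} → AllPairs _≢_ us → sum (map g us) ≤ vsum g
  vsum-distinct g []                         = z≤n
  vsum-distinct g {x ∷ us} (x≢us ∷ distinct) = begin
    g x + sum (map g us)              ≡⟨ cong (g x +_) (cong sum (map-cong-local (All.map erase-off x≢us))) ⟨
    g x + sum (map (erase x g) us)    ≤⟨ +-monoʳ-≤ (g x) (vsum-distinct (erase x g) distinct) ⟩
    g x + vsum (erase x g)            ≡⟨ vsum-erase g x ⟨
    vsum g                            ∎
    where
    open ≤-Reasoning
    erase-off : ∀ {u} → x ≢ u → erase x g u ≡ g u
    erase-off {u} x≢u with u ≟ᵥ x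
    ... | yes u≡x = contradiction (sym u≡x) x≢u
    ... | no _    = refl

pathAdj-sym : ∀ {n} {j j' : Fin n} → PathAdj j j' → PathAdj j' j
pathAdj-sym (inj₁ e) = inj₂ e
pathAdj-sym (inj₂ e) = inj₁ e

pathAdj-irrefl : ∀ {n} {j : Fin n} → ¬ PathAdj j j
pathAdj-irrefl (inj₁ e) = 1+n≢n (sym e)
pathAdj-irrefl (inj₂ e) = 1+n≢n (sym e)

module _ {m n : ℕ} where

  adj-sym : {u v : V m n} → Adj u v → Adj v u
  adj-sym (inj₁ (e , p)) = inj₁ (sym e , pathAdj-sym p)
  adj-sym (inj₂ (e , c)) = inj₂ (sym e , cycAdj-sym c)

  inClosedNbhd-sym : {u v : V m n} → InClosedNbhd u v → InClosedNbhd v u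
  inClosedNbhd-sym (inj₁ e) = inj₁ (sym e)
  inClosedNbhd-sym (inj₂ a) = inj₂ (adj-sym a)

  restrict : (V m n → ℕ) → V m n → V m n → ℕ
  restrict f v u = if ⌊ inClosed? u v ⌋ then f u else 0

  restrict-∈ : ∀ f {u v} → InClosedNbhd u v → restrict f v u ≡ f u
  restrict-∈ f {u} {v} u∈N[v] with inClosed? u v
  ... | yes _     = refl
  ... | no u∉N[v] = contradiction u∈N[v] u∉N[v]

  closedSum-point : ∀ f {v} x → InClosedNbhd x v → (∀ u → InClosedNbhd u v → u ≢ x → f u ≡ 0) →
                    closedSum f v ≡ f x
  closedSum-point f {v} x x∈N[v] f≡0 = trans (vsum-point (restrict f v) x off) (restrict-∈ f x∈N[v])
    where
    off : ∀ u → u ≢ x → restrict f v u ≡ 0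
    off u u≢x with inClosed? u v
    ... | yes u∈N[v] = f≡0 u u∈N[v] u≢x
    ... | no _       = refl

  closedSum-distinct : ∀ f {v us} → AllPairs _≢_ us → All (λ u → InClosedNbhd u v) us →
                       sum (map f us) ≤ closedSum f v
  closedSum-distinct f {v} {us} distinct us⊆N[v] = begin
    sum (map f us)              ≡⟨ cong sum (map-cong-local (All.map (sym ∘ restrict-∈ f) us⊆N[v])) ⟩
    sum (map (restrict f v) us) ≤⟨ vsum-distinct (restrict f v) distinct ⟩
    closedSum f v               ∎
    where open ≤-Reasoning

  closedSum-positive : ∀ f {v} → 0 < closedSum f v → ∃ λ u → InClosedNbhd u v × 0 < f u
  closedSum-positive f {v} pos with sum-map-positive (restrict f v) (vertices m n) pos
  ... | u , pos-u with inClosed? u v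
  ... | yes u∈N[v] = u , u∈N[v] , pos-u
  ... | no _       = contradiction pos-u λ ()

  count-≤1 : {P : Pred (V m n) 0ℓ} (P? : Decidable P) (x : V m n) → (∀ u → P u → u ≡ x) →
             length (filter P? (vertices m n)) ≤ 1
  count-≤1 P? x only-x = begin
    length (filter P? (vertices m n))   ≡⟨ length-filter≡sum-indicator P? (vertices m n) ⟩
    vsum (indicator P?)                 ≡⟨ vsum-point (indicator P?) x off ⟩
    indicator P? x                      ≤⟨ indicator≤1 ⟩
    1                                   ∎
    where
    open ≤-Reasoning
    off : ∀ u → u ≢ x → indicator P? u ≡ 0
    off u u≢x with P? u
    ... | yes Pu = contradiction (only-x u Pu) u≢x
    ... | no _   = refl
    indicator≤1 : indicator P? x ≤ 1
    indicator≤1 with does (P? x)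
    ... | true  = ≤-refl
    ... | false = z≤n

  count-distinct : {P : Pred (V m n) 0ℓ} (P? : Decidable P) {us : List (V m n)} →
                   AllPairs _≢_ us → All P us → length us ≤ length (filter P? (vertices m n))
  count-distinct P? {us} distinct all-P = begin
    length us                           ≡⟨ sum-indicator-All P? all-P ⟨
    sum (map (indicator P?) us)         ≤⟨ vsum-distinct (indicator P?) distinct ⟩
    vsum (indicator P?)                 ≡⟨ length-filter≡sum-indicator P? (vertices m n) ⟨
    length (filter P? (vertices m n))   ∎
    where open ≤-Reasoning

  active? : (f : V m n → ℕ) (v : V m n) → Decidable (λ u → Adj v u × 1 ≤ f u)
  active? f v u = adj? v u ×-dec (1 ≤? f u)

does⇒witness : ∀ {A : Set} (a? : Dec A) → does a? ≡ true → A
does⇒witness (yes a) _ = a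

module _ {m n : ℕ} .{{_ : NonZero m}} where

  -- N[(next x , j)], with positions written relative to x so that only next is needed.
  data Around (x : Fin m) (j : Fin n) : V m n → Set where
    left     : Around x j (x , j)
    centre   : Around x j (next x , j)
    right    : Around x j (next (next x) , j)
    vertical : ∀ {j'} → PathAdj j' j → Around x j (next x , j')

  around : ∀ {x j u} → InClosedNbhd (next x , j) u → Around x j u
  around (inj₁ refl)              = centre
  around (inj₂ (inj₁ (refl , p))) = vertical p
  around (inj₂ (inj₂ (refl , c))) with cycAdj⇒next c
  ... | inj₁ nextx≡nexta with refl ← next-injective nextx≡nexta = left
  ... | inj₂ refl = right

  around⁻¹ : ∀ {x j u} → Around x j u → InClosedNbhd (next x , j) u
  around⁻¹ {x} left   = inj₂ (inj₂ (refl , cycAdj-next x))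
  around⁻¹     centre = inj₁ refl
  around⁻¹ {x} right  = inj₂ (inj₂ (refl , cycAdj-sym (cycAdj-next (next x))))
  around⁻¹ (vertical p) = inj₂ (inj₁ (refl , p))

  two-neighbours : 3 ≤ m → ∀ (v : V m n) →
                   ∃₂ λ a b → Adj v a × Adj v b × AllPairs _≢_ (v ∷ a ∷ b ∷ [])
  two-neighbours 3≤m (i , j) =
    (next i , j) , (prev i , j) , inj₂ (refl , cycAdj-next i) , inj₂ (refl , cycAdj-prev) ,
    (i≢next ∘ cong proj₁ ∷ i≢prev ∘ cong proj₁ ∷ []) ∷ (next≢prev ∘ cong proj₁ ∷ []) ∷ [] ∷ []
    where
    cycAdj-prev : CycAdj i (prev i)
    cycAdj-prev = subst (λ z → CycAdj z (prev i)) (next-prev i) (cycAdj-sym (cycAdj-next (prev i)))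
    i≢next : i ≢ next i
    i≢next = next≢id (<⇒≤ 3≤m) i ∘ sym
    i≢prev : i ≢ prev i
    i≢prev i≡prev = i≢next (trans (sym (next-prev i)) (cong next (sym i≡prev)))
    next≢prev : next i ≢ prev i
    next≢prev next≡prev = next²≢id 3≤m i (trans (cong next next≡prev) (next-prev i))

-- Efficient dominating sets and perfect [k]-Roman dominating functions

eds⇒perfectKRDF : ∀ {m n} k → HasEDS m n → HasPerfectKRDF m n k
eds⇒perfectKRDF {m} {n} k (D , eds) = f , (bounded , roman) , perfect
  where
  f : V m n → ℕ
  f u = if D u then k + 1 else 0

  ∈D⇒heavy : ∀ {u} → D u ≡ true → f u ≡ k + 1
  ∈D⇒heavy {u} u∈D rewrite u∈D = refl

  positive⇒∈D : ∀ {u} → 0 < f u → D u ≡ true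
  positive⇒∈D {u} 0<fu with D u
  ... | true  = refl
  ... | false = contradiction 0<fu λ ()

  perfect : ∀ v → closedSum f v ≡ k + 1
  perfect v with eds v
  ... | x , (x∈D , v∈N[x]) , unique =
    trans (closedSum-point f x (inClosedNbhd-sym v∈N[x]) off) (∈D⇒heavy x∈D)
    where
    off : ∀ u → InClosedNbhd u v → u ≢ x → f u ≡ 0
    off u u∈N[v] u≢x with D u in u∈D
    ... | true  = contradiction (unique u u∈D (inClosedNbhd-sym u∈N[v])) u≢x
    ... | false = refl

  bounded : ∀ v → f v ≤ k + 1
  bounded v with D v
  ... | true  = ≤-refl
  ... | false = z≤n

  -- Every active neighbour of v lies in D and dominates v, so it is v's unique dominator;
  -- the bound holds for all v, light or not.
  roman : ∀ v → f v < k → k + activeNbrCount f v ≤ closedSum f v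
  roman v _ with eds v
  ... | x , _ , unique = subst (k + activeNbrCount f v ≤_) (sym (perfect v)) (+-monoʳ-≤ k
    (count-≤1 (active? f v) x λ u (vu , 0<fu) → unique u (positive⇒∈D 0<fu) (inj₂ (adj-sym vu))))

module PerfectKRDF {m n k : ℕ} .{{_ : NonZero m}} (3≤m : 3 ≤ m) (1≤k : 1 ≤ k) {f : V m n → ℕ}
                   (bounded : ∀ v → f v ≤ k + 1)
                   (roman : ∀ v → f v < k → k + activeNbrCount f v ≤ closedSum f v)
                   (perfect : ∀ v → closedSum f v ≡ k + 1) where

  closedSum≱k+2 : ∀ {v} → k + 1 + 1 ≰ closedSum f v
  closedSum≱k+2 {v} ≥k+2 = m+1+n≰m (k + 1) (subst (k + 1 + 1 ≤_) (perfect v) ≥k+2)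

  light⇒¬two-active : ∀ {w a b} → f w < k → Adj w a → Adj w b → a ≢ b → 0 < f a → 0 < f b → ⊥
  light⇒¬two-active {w} {a} {b} w<k wa wb a≢b 0<fa 0<fb = m+1+n≰m 1 (begin
    2                          ≤⟨ count-distinct (active? f w) ((a≢b ∷ []) ∷ [] ∷ []) ((wa , 0<fa) ∷ (wb , 0<fb) ∷ []) ⟩
    activeNbrCount f w         ≤⟨ +-cancelˡ-≤ k _ 1 (subst (k + activeNbrCount f w ≤_) (perfect w) (roman w w<k)) ⟩
    1                          ∎)
    where open ≤-Reasoning

  -- A neighbour w with f w = 0 would need a second active neighbour to reach f(N[w]) = k + 1.
  middling⇒neighbours-active : ∀ {v w} → 0 < f v → f v ≤ k → Adj v w → 0 < f w
  middling⇒neighbours-active {v} {w} 0<fv fv≤k vw with f w ≟ 0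
  ... | no fw≢0  = n≢0⇒n>0 fw≢0
  ... | yes fw≡0 = contradiction (≤-trans (≤-reflexive (trans (sym (perfect w)) only-v)) fv≤k) (m+1+n≰m k)
    where
    w<k : f w < k
    w<k = subst (_< k) (sym fw≡0) 1≤k
    off : ∀ u → InClosedNbhd u w → u ≢ v → f u ≡ 0
    off u (inj₁ refl) _ = fw≡0
    off u (inj₂ wu) u≢v with f u ≟ 0
    ... | yes fu≡0 = fu≡0
    ... | no fu≢0  = ⊥-elim (light⇒¬two-active w<k wu (adj-sym vw) u≢v (n≢0⇒n>0 fu≢0) 0<fv)
    only-v : closedSum f w ≡ f v
    only-v = closedSum-point f v (inj₂ (adj-sym vw)) off

  ¬middling : ∀ v → 0 < f v → f v ≤ k → ⊥
  ¬middling v 0<fv fv≤k with two-neighbours 3≤m v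
  ... | a , b , va , vb , distinct@(_ ∷ (a≢b ∷ []) ∷ _) = case f v <? k of λ where
      (yes fv<k) → light⇒¬two-active fv<k va vb a≢b (active va) (active vb)
      (no fv≮k)  → closedSum≱k+2 (begin
        k + 1 + 1                  ≡⟨ +-assoc k 1 1 ⟩
        k + (1 + (1 + 0))          ≤⟨ +-mono-≤ (≮⇒≥ fv≮k) (+-mono-≤ (active va) (+-mono-≤ (active vb) z≤n)) ⟩
        f v + (f a + (f b + 0))    ≤⟨ closedSum-distinct f distinct (inj₁ refl ∷ inj₂ va ∷ inj₂ vb ∷ []) ⟩
        closedSum f v              ∎)
    where
    open ≤-Reasoning
    active : ∀ {u} → Adj v u → 0 < f u
    active = middling⇒neighbours-active 0<fv fv≤k

  zero-or-k+1 : ∀ v → f v ≡ 0 ⊎ f v ≡ k + 1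
  zero-or-k+1 v with f v ≟ 0 | f v ≟ k + 1
  ... | yes fv≡0 | _          = inj₁ fv≡0
  ... | no _     | yes fv≡k+1 = inj₂ fv≡k+1
  ... | no fv≢0  | no fv≢k+1  = ⊥-elim (¬middling v (n≢0⇒n>0 fv≢0)
                                   (≤-pred (subst (f v <_) (+-comm k 1) (≤∧≢⇒< (bounded v) fv≢k+1))))

  heavy-unique : ∀ {v a b} → InClosedNbhd a v → InClosedNbhd b v → f a ≡ k + 1 → f b ≡ k + 1 → a ≡ b
  heavy-unique {v} {a} {b} a∈N[v] b∈N[v] fa≡k+1 fb≡k+1 with a ≟ᵥ b
  ... | yes a≡b = a≡b
  ... | no  a≢b = ⊥-elim (closedSum≱k+2 (begin
    k + 1 + 1                ≤⟨ +-mono-≤ (≤-reflexive (sym fa≡k+1)) (≤-trans (m≤n+m 1 k) (≤-reflexive (sym fb≡k+1))) ⟩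
    f a + f b                ≡⟨ cong (f a +_) (+-identityʳ (f b)) ⟨
    f a + (f b + 0)          ≤⟨ closedSum-distinct f ((a≢b ∷ []) ∷ [] ∷ []) (a∈N[v] ∷ b∈N[v] ∷ []) ⟩
    closedSum f v            ∎))
    where open ≤-Reasoning

  heavy-exists : ∀ v → ∃ λ u → InClosedNbhd u v × f u ≡ k + 1
  heavy-exists v with closedSum-positive f (subst (0 <_) (sym (perfect v)) (m≤n+m 1 k))
  ... | u , u∈N[v] , 0<fu with zero-or-k+1 u
  ...   | inj₁ fu≡0   = contradiction fu≡0 (>⇒≢ 0<fu)
  ...   | inj₂ fu≡k+1 = u , u∈N[v] , fu≡k+1

  efficient : IsEfficientDominating m n (λ u → does (f u ≟ k + 1))
  efficient v with heavy-exists v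
  ... | x , x∈N[v] , fx≡k+1 =
    x , (dec-true (f x ≟ k + 1) fx≡k+1 , inClosedNbhd-sym x∈N[v]) ,
    λ u u∈D v∈N[u] → heavy-unique (inClosedNbhd-sym v∈N[u]) x∈N[v] (does⇒witness (f u ≟ k + 1) u∈D) fx≡k+1

perfectKRDF⇒eds : ∀ {m n k} .{{_ : NonZero m}} → 3 ≤ m → 1 ≤ k → HasPerfectKRDF m n k → HasEDS m n
perfectKRDF⇒eds 3≤m 1≤k (f , (bounded , roman) , perfect) =
  _ , PerfectKRDF.efficient 3≤m 1≤k bounded roman perfect

-- Widths admitting an efficient dominating set

pathAdj-0F : ∀ {n} {j : Fin (2 + n)} → PathAdj j 0F → j ≡ 1F
pathAdj-0F                           (inj₁ ())
pathAdj-0F {j = 0F}                  (inj₂ ())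
pathAdj-0F {j = 1F}                  (inj₂ refl) = refl
pathAdj-0F {j = Fin.suc (Fin.suc _)} (inj₂ ())

pathAdj-1F : ∀ {n} {j : Fin (3 + n)} → PathAdj j 1F → j ≡ 0F ⊎ j ≡ 2F
pathAdj-1F {j = 0F}                            (inj₁ refl) = inj₁ refl
pathAdj-1F {j = 0F}                            (inj₂ ())
pathAdj-1F {j = 1F}                            (inj₁ ())
pathAdj-1F {j = 1F}                            (inj₂ ())
pathAdj-1F {j = 2F}                            (inj₁ ())
pathAdj-1F {j = 2F}                            (inj₂ refl) = inj₂ refl
pathAdj-1F {j = Fin.suc (Fin.suc (Fin.suc _))} (inj₁ ())
pathAdj-1F {j = Fin.suc (Fin.suc (Fin.suc _))} (inj₂ ())

-- Row 3 exists only when n ≥ 4, hence the second alternative is stated through toℕ.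
pathAdj-2F : ∀ {n} {j : Fin (3 + n)} → PathAdj j 2F → j ≡ 1F ⊎ toℕ j ≡ 3
pathAdj-2F {j = 0F}                  (inj₁ ())
pathAdj-2F {j = 1F}                  (inj₁ refl) = inj₁ refl
pathAdj-2F {j = Fin.suc (Fin.suc _)} (inj₁ ())
pathAdj-2F                           (inj₂ j≡3)  = inj₂ j≡3

module EfficientDominatingSet {m n : ℕ} .{{_ : NonZero m}} (3≤m : 3 ≤ m)
                              {D : V m n → Bool} (eds : IsEfficientDominating m n D) where

  In : V m n → Set
  In u = D u ≡ true

  dominator : ∀ x j → ∃ λ u → In u × Around x j u
  dominator x j with eds (next x , j)
  ... | u , (u∈D , v∈N[u]) , _ = u , u∈D , around v∈N[u]

  dominators-coincide : ∀ {a b w} → In a → In b → InClosedNbhd w a → InClosedNbhd w b → a ≡ b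
  dominators-coincide {w = w} a∈D b∈D w∈N[a] w∈N[b] with eds w
  ... | _ , _ , unique = trans (unique _ a∈D w∈N[a]) (sym (unique _ b∈D w∈N[b]))

  ¬In-next : ∀ {i j} → In (i , j) → ¬ In (next i , j)
  ¬In-next {i} {j} a∈D b∈D = next≢id (<⇒≤ 3≤m) i
    (sym (cong proj₁ (dominators-coincide a∈D b∈D (around⁻¹ left) (around⁻¹ centre))))

  ¬In-next² : ∀ {i j} → In (i , j) → ¬ In (next (next i) , j)
  ¬In-next² {i} {j} a∈D b∈D = next²≢id 3≤m i
    (sym (cong proj₁ (dominators-coincide a∈D b∈D (around⁻¹ left) (around⁻¹ right))))

  ¬In-vertical : ∀ {i j j'} → PathAdj j j' → In (i , j) → ¬ In (i , j')
  ¬In-vertical {i} {j} {j'} p a∈D b∈D = pathAdj-irrefl (subst (PathAdj j) (sym j≡j') p)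
    where
    j≡j' : j ≡ j'
    j≡j' = cong proj₂ (dominators-coincide a∈D b∈D (inj₁ refl) (inj₂ (inj₁ (refl , pathAdj-sym p))))

  ¬In-diagonal : ∀ {i j j'} → PathAdj j j' → In (i , j) → ¬ In (next i , j')
  ¬In-diagonal {i} {j} p a∈D b∈D = next≢id (<⇒≤ 3≤m) i
    (sym (cong proj₁ (dominators-coincide a∈D b∈D (around⁻¹ left) (around⁻¹ (vertical (pathAdj-sym p))))))

  ¬In-vertical² : ∀ {i j j' j''} → PathAdj j j' → PathAdj j' j'' → j ≢ j'' → In (i , j) → ¬ In (i , j'')
  ¬In-vertical² {i} {j' = j'} p q j≢j'' a∈D b∈D =
    j≢j'' (cong proj₂ (dominators-coincide a∈D b∈D (inj₂ (inj₁ (refl , p))) (inj₂ (inj₁ (refl , pathAdj-sym q)))))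

module Width1 {m : ℕ} .{{_ : NonZero m}} (3≤m : 3 ≤ m)
              {D : V m 1 → Bool} (eds : IsEfficientDominating m 1 D) where
  open EfficientDominatingSet 3≤m eds

  step : ∀ {i} → In (i , 0F) → In (next^ 3 i , 0F)
  step {i} i∈D with dominator (next i) 0F
  ... | _ , u∈D , left   = ⊥-elim (¬In-next i∈D u∈D)
  ... | _ , u∈D , centre = ⊥-elim (¬In-next² i∈D u∈D)
  ... | _ , u∈D , right  = u∈D
  ... | _ , _ , vertical (inj₁ ())
  ... | _ , _ , vertical {j' = 0F} (inj₂ ())

  separated : ∀ {i} r → 0 < r → r < 3 → In (i , 0F) → ¬ In (next^ r i , 0F)
  separated 0 () _
  separated 1 _ _ = ¬In-next
  separated 2 _ _ = ¬In-next²
  separated (suc (suc (suc _))) _ (s≤s (s≤s (s≤s ())))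

  3∣m : Fin m → 3 ∣ m
  3∣m x with dominator x 0F
  ... | (i , 0F) , i∈D , _ = period⇒∣ (λ i → In (i , 0F)) 3 step separated i∈D

eds-width1⇒3∣m : ∀ {m} .{{_ : NonZero m}} → 3 ≤ m → HasEDS m 1 → 3 ∣ m
eds-width1⇒3∣m {suc _} 3≤m (_ , eds) = Width1.3∣m 3≤m eds Fin.zero

module Width≥2 {m n : ℕ} .{{_ : NonZero m}} (3≤m : 3 ≤ m)
               {D : V m (2 + n) → Bool} (eds : IsEfficientDominating m (2 + n) D) where
  open EfficientDominatingSet 3≤m eds public

  0~1 : PathAdj {2 + n} 0F 1F
  0~1 = inj₁ refl

  1~0 : PathAdj {2 + n} 1F 0F
  1~0 = inj₂ refl

  row0-member : Fin m → ∃ λ i → In (i , 0F)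
  row0-member x with dominator x 0F
  ... | _ , u∈D , left   = _ , u∈D
  ... | _ , u∈D , centre = _ , u∈D
  ... | _ , u∈D , right  = _ , u∈D
  ... | _ , u∈D , vertical p with refl ← pathAdj-0F p with dominator (next x) 0F
  ...   | _ , w∈D , left   = ⊥-elim (¬In-vertical 0~1 w∈D u∈D)
  ...   | _ , w∈D , centre = ⊥-elim (¬In-diagonal 1~0 u∈D w∈D)
  ...   | _ , w∈D , right  = _ , w∈D
  ...   | _ , w∈D , vertical q with refl ← pathAdj-0F q = ⊥-elim (¬In-next u∈D w∈D)

  row0-step : ∀ {i} → In (i , 0F) → In (next (next i) , 1F) → In (next^ 4 i , 0F)
  row0-step {i} i∈D i₂∈D with dominator (next (next i)) 0F
  ... | _ , u∈D , left   = ⊥-elim (¬In-next² i∈D u∈D)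
  ... | _ , u∈D , centre = ⊥-elim (¬In-diagonal 1~0 i₂∈D u∈D)
  ... | _ , u∈D , right  = u∈D
  ... | _ , u∈D , vertical p with refl ← pathAdj-0F p = ⊥-elim (¬In-next i₂∈D u∈D)

module Width2 {m : ℕ} .{{_ : NonZero m}} (3≤m : 3 ≤ m)
              {D : V m 2 → Bool} (eds : IsEfficientDominating m 2 D) where
  open Width≥2 3≤m eds

  row1-forced : ∀ {i} → In (i , 0F) → In (next (next i) , 1F)
  row1-forced {i} i∈D with dominator i 1F
  ... | _ , u∈D , left   = ⊥-elim (¬In-vertical 0~1 i∈D u∈D)
  ... | _ , u∈D , centre = ⊥-elim (¬In-diagonal 0~1 i∈D u∈D)
  ... | _ , u∈D , right  = u∈D
  ... | _ , u∈D , vertical {j' = 0F} _ = ⊥-elim (¬In-next i∈D u∈D)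
  ... | _ , _   , vertical {j' = 1F} (inj₁ ())
  ... | _ , _   , vertical {j' = 1F} (inj₂ ())

  separated : ∀ {i} r → 0 < r → r < 4 → In (i , 0F) → ¬ In (next^ r i , 0F)
  separated 0 () _
  separated 1 _ _ = ¬In-next
  separated 2 _ _ = ¬In-next²
  separated 3 _ _ = ¬In-diagonal 1~0 ∘ row1-forced
  separated (suc (suc (suc (suc _)))) _ (s≤s (s≤s (s≤s (s≤s ()))))

  4∣m : Fin m → 4 ∣ m
  4∣m x = period⇒∣ (λ i → In (i , 0F)) 4 (λ i∈D → row0-step i∈D (row1-forced i∈D)) separated
                    (proj₂ (row0-member x))

eds-width2⇒4∣m : ∀ {m} .{{_ : NonZero m}} → 3 ≤ m → HasEDS m 2 → 4 ∣ m
eds-width2⇒4∣m {suc _} 3≤m (_ , eds) = Width2.4∣m 3≤m eds Fin.zero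

module Width≥3 {m n : ℕ} .{{_ : NonZero m}} (3≤m : 3 ≤ m)
               {D : V m (3 + n) → Bool} (eds : IsEfficientDominating m (3 + n) D) where
  open Width≥2 3≤m eds

  1~2 : PathAdj {3 + n} 1F 2F
  1~2 = inj₁ refl

  2~1 : PathAdj {3 + n} 2F 1F
  2~1 = inj₂ refl

  gap3⇒row2 : ∀ {i} → In (i , 0F) → In (next (next (next i)) , 0F) → In (next i , 2F)
  gap3⇒row2 {i} i∈D i₃∈D with dominator i 1F
  ... | _ , u∈D , left   = ⊥-elim (¬In-vertical 0~1 i∈D u∈D)
  ... | _ , u∈D , centre = ⊥-elim (¬In-diagonal 0~1 i∈D u∈D)
  ... | _ , u∈D , right  = ⊥-elim (¬In-diagonal 1~0 u∈D i₃∈D)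
  ... | _ , u∈D , vertical p with pathAdj-1F p
  ...   | inj₁ refl = ⊥-elim (¬In-next i∈D u∈D)
  ...   | inj₂ refl = u∈D

  ¬gap3 : ∀ {i} → In (i , 0F) → ¬ In (next (next (next i)) , 0F)
  ¬gap3 {i} i∈D i₃∈D with dominator (next i) 1F
  ... | _ , u∈D , left   = ¬In-diagonal 0~1 i∈D u∈D
  ... | _ , u∈D , centre = ¬In-diagonal 1~0 u∈D i₃∈D
  ... | _ , u∈D , right  = ¬In-vertical 0~1 i₃∈D u∈D
  ... | _ , u∈D , vertical p with pathAdj-1F p
  ...   | inj₁ refl = ¬In-next² i∈D u∈D
  ...   | inj₂ refl = ¬In-next (gap3⇒row2 i∈D i₃∈D) u∈D

  row3-member : ∀ {i} → In (i , 0F) → In (next (next i) , 1F) → ∃ λ j → toℕ j ≡ 3 × In (next i , j)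
  row3-member {i} i∈D i₂∈D with dominator i 2F
  ... | _ , u∈D , left   = ⊥-elim (¬In-vertical² 0~1 1~2 (λ ()) i∈D u∈D)
  ... | _ , u∈D , centre = ⊥-elim (¬In-diagonal 2~1 u∈D i₂∈D)
  ... | _ , u∈D , right  = ⊥-elim (¬In-vertical 1~2 i₂∈D u∈D)
  ... | _ , u∈D , vertical p with pathAdj-2F p
  ...   | inj₁ refl = ⊥-elim (¬In-diagonal 0~1 i∈D u∈D)
  ...   | inj₂ j≡3  = _ , j≡3 , u∈D

  ¬diagonal-step : ∀ {i} → In (i , 0F) → ¬ In (next (next i) , 1F)
  ¬diagonal-step {i} i∈D i₂∈D with row3-member i∈D i₂∈D | dominator (next (next i)) 2F
  ... | _ | _ , u∈D , left   = ¬In-vertical 1~2 i₂∈D u∈D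
  ... | _ | _ , u∈D , centre = ¬In-diagonal 1~2 i₂∈D u∈D
  ... | _ | _ , u∈D , right  = ¬In-vertical² 0~1 1~2 (λ ()) (row0-step i∈D i₂∈D) u∈D
  ... | j , j≡3 , w∈D | _ , u∈D , vertical p with pathAdj-2F p
  ...   | inj₁ refl = ¬In-next i₂∈D u∈D
  ...   | inj₂ j'≡3 with refl ← toℕ-injective (trans j≡3 (sym j'≡3)) = ¬In-next² w∈D u∈D

  impossible : Fin m → ⊥
  impossible x with row0-member x
  ... | i , i∈D with dominator (next i) 0F
  ...   | _ , u∈D , left   = ¬In-next i∈D u∈D
  ...   | _ , u∈D , centre = ¬In-next² i∈D u∈D
  ...   | _ , u∈D , right  = ¬gap3 i∈D u∈D
  ...   | _ , u∈D , vertical p with refl ← pathAdj-0F p = ¬diagonal-step i∈D u∈D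

¬eds-width≥3 : ∀ {m n} .{{_ : NonZero m}} → 3 ≤ m → ¬ HasEDS m (3 + n)
¬eds-width≥3 {suc _} 3≤m (_ , eds) = Width≥3.impossible 3≤m eds Fin.zero

-- Periodic efficient dominating sets

module ViaAround {m n : ℕ} .{{_ : NonZero m}} (D : V m n → Bool) where

  Settled : V m n → V m n → Set
  Settled u w = D w ≡ false ⊎ w ≡ u

  settled-around : ∀ {u x j} → Settled u (x , j) → Settled u (next x , j) → Settled u (next (next x) , j) →
                   (∀ {j'} → PathAdj j' j → Settled u (next x , j')) → ∀ {w} → Around x j w → Settled u w
  settled-around s _ _ _ left         = s
  settled-around _ s _ _ centre       = s
  settled-around _ _ s _ right        = s
  settled-around _ _ _ s (vertical p) = s p

  settled-sole-vertical : ∀ {u x j j₀} → (∀ {j'} → PathAdj j' j → j' ≡ j₀) → Settled u (next x , j₀) →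
                          ∀ {j'} → PathAdj j' j → Settled u (next x , j')
  settled-sole-vertical sole s p rewrite sole p = s

  UniqueAround : Fin m → Fin n → Set
  UniqueAround x j = ∃ λ u → (D u ≡ true × Around x j u) × (∀ {w} → Around x j w → Settled u w)

  efficient-via-around : (∀ x j → UniqueAround x j) → IsEfficientDominating m n D
  efficient-via-around unique (i , j) with unique (prev i) j
  ... | u , (u∈D , u-around) , settled =
    u , (u∈D , recentre (next-prev i) (around⁻¹ u-around)) ,
    λ w w∈D v∈N[w] → resolve w∈D (settled (around (recentre (sym (next-prev i)) v∈N[w])))
    where
    recentre : ∀ {i₁ i₂ w} → i₁ ≡ i₂ → InClosedNbhd (i₁ , j) w → InClosedNbhd (i₂ , j) w
    recentre {w = w} i₁≡i₂ = subst (λ z → InClosedNbhd (z , j) w) i₁≡i₂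
    resolve : ∀ {w} → D w ≡ true → Settled u w → w ≡ u
    resolve w∈D (inj₁ w∉D) = contradiction (trans (sym w∈D) w∉D) λ ()
    resolve _   (inj₂ w≡u) = w≡u

module ResiduePattern {m n : ℕ} (p : ℕ) .{{_ : NonZero m}} .{{_ : NonZero p}} (p∣m : p ∣ m)
                      (offset : Fin n → Fin p) where

  member : V m n → Bool
  member (i , j) = does (residue p i ≟ᶠ offset j)

  -- For a literal residue r these reduce membership near (next x , j) to a closed boolean, so the
  -- case analyses below only have to name the one candidate whose residue matches.
  module _ (x : Fin m) {r} (x≡r : residue p x ≡ r) (j : Fin n) where

    member-left : member (x , j) ≡ does (r ≟ᶠ offset j)
    member-left = cong (λ s → does (s ≟ᶠ offset j)) x≡r

    member-centre : member (next x , j) ≡ does (next r ≟ᶠ offset j)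
    member-centre = cong (λ s → does (s ≟ᶠ offset j)) (trans (residue-next p∣m x) (cong next x≡r))

    member-right : member (next (next x) , j) ≡ does (next (next r) ≟ᶠ offset j)
    member-right = cong (λ s → does (s ≟ᶠ offset j))
      (trans (residue-next p∣m (next x)) (cong next (trans (residue-next p∣m x) (cong next x≡r))))

no-vertical-width1 : ∀ {j j' : Fin 1} → ¬ PathAdj j' j
no-vertical-width1 {0F} {0F} (inj₁ ())
no-vertical-width1 {0F} {0F} (inj₂ ())

pathAdj-1F-width2 : ∀ {j : Fin 2} → PathAdj j 1F → j ≡ 0F
pathAdj-1F-width2 {0F} _ = refl
pathAdj-1F-width2 {1F} (inj₁ ())
pathAdj-1F-width2 {1F} (inj₂ ())

3∣m⇒eds-width1 : ∀ {m} .{{_ : NonZero m}} → 3 ∣ m → HasEDS m 1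
3∣m⇒eds-width1 3∣m = member , efficient-via-around unique
  where
  open ResiduePattern 3 3∣m (λ _ → 0F)
  open ViaAround member
  unique : ∀ x j → UniqueAround x j
  unique x 0F with residue 3 x in x≡r
  ... | 0F = (x , 0F) , (member-left x x≡r 0F , left) ,
             settled-around (inj₂ refl) (inj₁ (member-centre x x≡r 0F)) (inj₁ (member-right x x≡r 0F))
                            (⊥-elim ∘ no-vertical-width1)
  ... | 1F = (next (next x) , 0F) , (member-right x x≡r 0F , right) ,
             settled-around (inj₁ (member-left x x≡r 0F)) (inj₁ (member-centre x x≡r 0F)) (inj₂ refl)
                            (⊥-elim ∘ no-vertical-width1)
  ... | 2F = (next x , 0F) , (member-centre x x≡r 0F , centre) ,
             settled-around (inj₁ (member-left x x≡r 0F)) (inj₂ refl) (inj₁ (member-right x x≡r 0F))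
                            (⊥-elim ∘ no-vertical-width1)

4∣m⇒eds-width2 : ∀ {m} .{{_ : NonZero m}} → 4 ∣ m → HasEDS m 2
4∣m⇒eds-width2 4∣m = member , efficient-via-around unique
  where
  offset : Fin 2 → Fin 4
  offset 0F = 0F
  offset 1F = 2F
  open ResiduePattern 4 4∣m offset
  open ViaAround member
  unique : ∀ x j → UniqueAround x j
  unique x j with residue 4 x in x≡r
  unique x 0F | 0F = (x , 0F) , (member-left x x≡r 0F , left) ,
    settled-around (inj₂ refl) (inj₁ (member-centre x x≡r 0F)) (inj₁ (member-right x x≡r 0F))
                   (settled-sole-vertical pathAdj-0F (inj₁ (member-centre x x≡r 1F)))
  unique x 0F | 1F = (next x , 1F) , (member-centre x x≡r 1F , vertical (inj₂ refl)) ,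
    settled-around (inj₁ (member-left x x≡r 0F)) (inj₁ (member-centre x x≡r 0F)) (inj₁ (member-right x x≡r 0F))
                   (settled-sole-vertical pathAdj-0F (inj₂ refl))
  unique x 0F | 2F = (next (next x) , 0F) , (member-right x x≡r 0F , right) ,
    settled-around (inj₁ (member-left x x≡r 0F)) (inj₁ (member-centre x x≡r 0F)) (inj₂ refl)
                   (settled-sole-vertical pathAdj-0F (inj₁ (member-centre x x≡r 1F)))
  unique x 0F | 3F = (next x , 0F) , (member-centre x x≡r 0F , centre) ,
    settled-around (inj₁ (member-left x x≡r 0F)) (inj₂ refl) (inj₁ (member-right x x≡r 0F))
                   (settled-sole-vertical pathAdj-0F (inj₁ (member-centre x x≡r 1F)))
  unique x 1F | 0F = (next (next x) , 1F) , (member-right x x≡r 1F , right) ,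
    settled-around (inj₁ (member-left x x≡r 1F)) (inj₁ (member-centre x x≡r 1F)) (inj₂ refl)
                   (settled-sole-vertical pathAdj-1F-width2 (inj₁ (member-centre x x≡r 0F)))
  unique x 1F | 1F = (next x , 1F) , (member-centre x x≡r 1F , centre) ,
    settled-around (inj₁ (member-left x x≡r 1F)) (inj₂ refl) (inj₁ (member-right x x≡r 1F))
                   (settled-sole-vertical pathAdj-1F-width2 (inj₁ (member-centre x x≡r 0F)))
  unique x 1F | 2F = (x , 1F) , (member-left x x≡r 1F , left) ,
    settled-around (inj₂ refl) (inj₁ (member-centre x x≡r 1F)) (inj₁ (member-right x x≡r 1F))
                   (settled-sole-vertical pathAdj-1F-width2 (inj₁ (member-centre x x≡r 0F)))
  unique x 1F | 3F = (next x , 0F) , (member-centre x x≡r 0F , vertical (inj₁ refl)) ,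
    settled-around (inj₁ (member-left x x≡r 1F)) (inj₁ (member-centre x x≡r 1F)) (inj₁ (member-right x x≡r 1F))
                   (settled-sole-vertical pathAdj-1F-width2 (inj₂ refl))

eds⇒shape : ∀ {m n} .{{_ : NonZero m}} → 3 ≤ m → 1 ≤ n → HasEDS m n → (n ≡ 1 × 3 ∣ m) ⊎ (n ≡ 2 × 4 ∣ m)
eds⇒shape {n = 0}                   _   () _
eds⇒shape {n = 1}                   3≤m _ eds = inj₁ (refl , eds-width1⇒3∣m 3≤m eds)
eds⇒shape {n = 2}                   3≤m _ eds = inj₂ (refl , eds-width2⇒4∣m 3≤m eds)
eds⇒shape {n = suc (suc (suc _))}   3≤m _ eds = ⊥-elim (¬eds-width≥3 3≤m eds)

shape⇒eds : ∀ {m n} .{{_ : NonZero m}} → (n ≡ 1 × 3 ∣ m) ⊎ (n ≡ 2 × 4 ∣ m) → HasEDS m n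
shape⇒eds (inj₁ (refl , 3∣m)) = 3∣m⇒eds-width1 3∣m
shape⇒eds (inj₂ (refl , 4∣m)) = 4∣m⇒eds-width2 4∣m

theorem2 : (m n k : ℕ) → 3 ≤ m → 1 ≤ n → 1 ≤ k →
    (HasEDS m n ⇔ HasPerfectKRDF m n k) ×
    (HasPerfectKRDF m n k ⇔ ((n ≡ 1 × 3 ∣ m) ⊎ (n ≡ 2 × 4 ∣ m)))
theorem2 m@(suc _) n k 3≤m 1≤n 1≤k =
  mk⇔ (eds⇒perfectKRDF k) krdf⇒eds ,
  mk⇔ (eds⇒shape 3≤m 1≤n ∘ krdf⇒eds) (eds⇒perfectKRDF k ∘ shape⇒eds)
  where
  krdf⇒eds : HasPerfectKRDF m n k → HasEDS m n
  krdf⇒eds = perfectKRDF⇒eds 3≤m 1≤k
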